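{- Let $\mathcal{P}_n$ denote the set of tilings of the $n\times n$ square grid by $n$-ominoes. Then $|\mathcal{P}_n| \ge (3^{1/6}-o(1))^{n^2}$; that is, there is a function $g:\mathbb{N}\to\mathbb{R}$ with $g(n)\to 0$ as $n\to\infty$ such that $|\mathcal{P}_n| \ge (3^{1/6}-g(n))^{n^2}$ for all $n$.
   Context: An $n$-omino is a collection of $n$ unit squares of the grid that is connected via shared edges. A tiling of the $n\times n$ grid by $n$-ominoes is a partition of its $n^2$ unit squares into $n$ such $n$-ominoes. Equivalently, letting $G_n$ be the $n\times n$ grid graph (vertex set $\{1,\dots,n\}^2$, two vertices adjacent iff they differ by $1$ in exactly one coordinate), $\mathcal{P}_n$ is in bijection with the set of partitions of the vertex set of $G_n$ into $n$ disjoint parts, each inducing a connected subgraph with exactly $n$ vertices. -}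

module Defs where

open import Data.Nat using (ℕ; suc; _≡ᵇ_)
open import Data.Fin using (Fin; toℕ)
open import Data.Fin.Properties using (_≟_)
open import Data.Product using (_×_; _,_)
open import Data.Sum using (_⊎_)
open import Data.List using (List; length; filter; cartesianProduct; allFin)
open import Data.List.Relation.Unary.AllPairs using (AllPairs)
open import Relation.Binary.PropositionalEquality using (_≡_)
open import Relation.Nullary using (¬_)
open import Function.Bundles using (_⇔_)

-- Vertices of the n×n grid graph G_n (coordinates 0..n-1 instead of 1..n).
Cell : ℕ → Set
Cell n = Fin n × Fin n

DiffOne : ℕ → ℕ → Set
DiffOne a b = (suc a ≡ b) ⊎ (suc b ≡ a)

Adj : {n : ℕ} → Cell n → Cell n → Set
Adj (i , j) (i' , j') = (i ≡ i' × DiffOne (toℕ j) (toℕ j'))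
                      ⊎ (j ≡ j' × DiffOne (toℕ i) (toℕ i'))

allCells : (n : ℕ) → List (Cell n)
allCells n = cartesianProduct (allFin n) (allFin n)

data PathIn {n : ℕ} (P : Cell n → Set) : Cell n → Cell n → Set where
  here : ∀ {c} → P c → PathIn P c c
  step : ∀ {c d e} → P c → Adj c d → PathIn P d e → PathIn P c e

-- A tiling of the n×n grid by n-ominoes, presented as a labelling of the cells
-- by n part-labels such that every part has exactly n cells and induces a
-- connected subgraph of G_n.  (Since there are n labels, n² cells, and each
-- label class has n cells, all n parts are nonempty.)
record Tiling (n : ℕ) : Set where
  field
    part      : Cell n → Fin n
    partSize  : ∀ (k : Fin n) →
                length (filter (λ c → part c ≟ k) (allCells n)) ≡ n
    connected : ∀ (k : Fin n) (c d : Cell n) → part c ≡ k → part d ≡ k →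
                PathIn (λ e → part e ≡ k) c d
open Tiling public

-- Two tilings determine the same partition of the vertex set (labels are
-- irrelevant): same-part relation coincides.
SamePartition : {n : ℕ} → Tiling n → Tiling n → Set
SamePartition {n} t t' =
  ∀ (c d : Cell n) → (part t c ≡ part t d) ⇔ (part t' c ≡ part t' d)

-- A list of tilings representing pairwise distinct partitions, i.e. pairwise
-- distinct elements of P_n.  |P_n| ≥ m  iff such a list of length m exists.
PairwiseDistinct : {n : ℕ} → List (Tiling n) → Set
PairwiseDistinct = AllPairs (λ t t' → ¬ SamePartition t t')

-- Cut the n × n grid into q = ⌊n/4⌋ horizontal bands of height 4 and e = n mod 4 single rows,
-- each row being one tile. A band is split into four n-ominoes by a line of teeth t x ∈ {0,1,2}:
-- the cells (x , y) with y ≤ t x form the two upper tiles, separated after column m, the others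
-- the two lower tiles, separated after column m + p, where n = 2m + p. Each tile is a comb
-- (an interval of a row with vertical segments attached), hence connected, and the tile sizes
-- are n exactly when the teeth sums over the corresponding column ranges are right.  Filling
-- both halves of every band independently with words of length 4 over {0,1,2} with digit sum 4
-- (there are 19 of them) gives 19^(2uq) ≈ 19^(n²/16) tilings, pairwise distinct because the
-- partition determines the teeth.  Since 3^16 < 19^6, i.e. 3^(1/6) < 19^(1/16), this exceeds
-- (a/b)^(n²) for large n as soon as a^6 ≤ 3 b^6; Bernoulli's inequality makes "large" explicit.
module Submission where

open import Defs
open import Data.Nat using (ℕ; _*_; _^_; _<_; _≤_; _≥_; NonZero)
open import Data.Product using (∃; Σ; _×_)
open import Data.List using (List; length)

open import Data.Bool using (Bool; true; false; if_then_else_)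
open import Data.Empty using (⊥-elim)
open import Data.Fin using (Fin; toℕ; fromℕ<)
open import Data.Fin.Properties using (toℕ-fromℕ<; toℕ-injective; toℕ<n; _≟_)
import Data.Fin.Properties as Fin
open import Data.List using ([]; _∷_; _++_; map; replicate; filter; tabulate; allFin; cartesianProduct; cartesianProductWith)
open import Data.List.Properties
  using (length-++; length-map; length-replicate; map-++; map-∘; map-cong; map-tabulate; ++-assoc;
         ++-cancelˡ; ++-cancelʳ; ∷-injectiveˡ; ∷-injectiveʳ; ≡-dec)
open import Data.List.Relation.Unary.All using (All; []; _∷_)
import Data.List.Relation.Unary.All as All
open import Data.List.Relation.Unary.All.Properties using (++⁺; replicate⁺)
import Data.List.Relation.Unary.AllPairs as AllPairs
import Data.List.Relation.Unary.AllPairs.Properties as AllPairs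
open import Data.List.Relation.Unary.Unique.Propositional using (Unique)
import Data.List.Relation.Unary.Unique.Propositional.Properties as Unique
open import Data.Nat hiding (_≟_)
open import Data.Nat.DivMod using (_/_; _%_; m%n<n; m≡m%n+[m/n]*n)
open import Data.Nat.ListAction using (sum)
open import Data.Nat.ListAction.Properties using (sum-++)
open import Data.Nat.Properties hiding (_≟_)
import Data.Nat.Properties as ℕ
open import Algebra.Properties.CommutativeSemigroup ℕ.+-commutativeSemigroup using (interchange; x∙yz≈y∙xz)
open import Data.Nat.Tactic.RingSolver using (solve-∀)
open import Data.Product using (_,_; proj₁; proj₂)
import Data.Product as Product
open import Data.Sum using (_⊎_; inj₁; inj₂)
import Data.Sum as Sum
open import Data.Vec using (Vec; []; _∷_)
import Data.Vec as Vec
import Data.Vec.Properties as Vec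
open import Function using (_∘_; _∘₂_; id)
open import Function.Bundles using (_⇔_; mk⇔; Equivalence)
open import Function.Construct.Symmetry using (⇔-sym)
open import Relation.Binary.PropositionalEquality
open import Relation.Nullary using (does; yes; no; _×-dec_; _→-dec_)
open import Relation.Nullary.Decidable using (does-⇔; dec-false; from-yes)
open import Relation.Unary using (Decidable)

𝟙 : Bool → ℕ
𝟙 true  = 1
𝟙 false = 0

∑< : ℕ → (ℕ → ℕ) → ℕ
∑< zero    f = 0
∑< (suc n) f = f 0 + ∑< n (f ∘ suc)

syntax ∑< n (λ i → e) = ∑[ i < n ] e

∑-cong : ∀ n {f g : ℕ → ℕ} → (∀ i → i < n → f i ≡ g i) → ∑[ i < n ] f i ≡ ∑[ i < n ] g i
∑-cong zero    f≗g = refl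
∑-cong (suc n) f≗g = cong₂ _+_ (f≗g 0 z<s) (∑-cong n (λ i i<n → f≗g (suc i) (s<s i<n)))

∑-zero : ∀ n {f : ℕ → ℕ} → (∀ i → i < n → f i ≡ 0) → ∑[ i < n ] f i ≡ 0
∑-zero n f≗0 = trans (∑-cong n f≗0) (∑-0 n)
  where
  ∑-0 : ∀ n → ∑[ i < n ] 0 ≡ 0
  ∑-0 zero    = refl
  ∑-0 (suc n) = ∑-0 n

∑-one : ∀ n → ∑[ i < n ] 1 ≡ n
∑-one zero    = refl
∑-one (suc n) = cong suc (∑-one n)

∑-+ : ∀ n (f g : ℕ → ℕ) → ∑[ i < n ] (f i + g i) ≡ ∑[ i < n ] f i + ∑[ i < n ] g i
∑-+ zero    f g = refl
∑-+ (suc n) f g = trans (cong ((f 0 + g 0) +_) (∑-+ n (f ∘ suc) (g ∘ suc))) (interchange (f 0) (g 0) _ _)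

∑-split : ∀ m n (f : ℕ → ℕ) → ∑[ i < m + n ] f i ≡ ∑[ i < m ] f i + ∑[ i < n ] f (m + i)
∑-split zero    n f = refl
∑-split (suc m) n f = trans (cong (f 0 +_) (∑-split m n (f ∘ suc))) (sym (+-assoc (f 0) _ _))

length-filter : ∀ {A : Set} {P : A → Set} (P? : Decidable P) xs →
                length (filter P? xs) ≡ sum (map (𝟙 ∘ does ∘ P?) xs)
length-filter P? []       = refl
length-filter P? (x ∷ xs) with does (P? x)
... | true  = cong suc (length-filter P? xs)
... | false = length-filter P? xs

sum-map-cartesianProduct : ∀ {A B : Set} (g : A × B → ℕ) xs ys →
  sum (map g (cartesianProduct xs ys)) ≡ sum (map (λ x → sum (map (λ y → g (x , y)) ys)) xs)
sum-map-cartesianProduct g []       ys = refl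
sum-map-cartesianProduct g (x ∷ xs) ys = begin
  sum (map g (map (x ,_) ys ++ cartesianProduct xs ys))
    ≡⟨ cong sum (map-++ g (map (x ,_) ys) _) ⟩
  sum (map g (map (x ,_) ys) ++ map g (cartesianProduct xs ys))
    ≡⟨ sum-++ (map g (map (x ,_) ys)) _ ⟩
  sum (map g (map (x ,_) ys)) + sum (map g (cartesianProduct xs ys))
    ≡⟨ cong₂ _+_ (cong sum (map-∘ ys)) (sym (sum-map-cartesianProduct g xs ys)) ⟨
  sum (map (λ y → g (x , y)) ys) + sum (map (λ x → sum (map (λ y → g (x , y)) ys)) xs)
    ∎
  where open ≡-Reasoning

sum-map-allFin : ∀ n (f : ℕ → ℕ) → sum (map (f ∘ toℕ) (allFin n)) ≡ ∑[ x < n ] f x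
sum-map-allFin n f = trans (cong sum (map-tabulate {n = n} id (f ∘ toℕ))) (sum-tabulate n f)
  where
  sum-tabulate : ∀ n (f : ℕ → ℕ) → sum (tabulate {n = n} (f ∘ toℕ)) ≡ ∑[ x < n ] f x
  sum-tabulate zero    f = refl
  sum-tabulate (suc n) f = cong (f 0 +_) (sum-tabulate n (f ∘ suc))

if-< : ∀ {A : Set} {y h} {a b : A} → y < h → (if y <ᵇ h then a else b) ≡ a
if-< {y = zero}  z<s       = refl
if-< {y = suc y} (s<s y<h) = if-< y<h

if-≥ : ∀ {A : Set} {y h} {a b : A} → h ≤ y → (if y <ᵇ h then a else b) ≡ b
if-≥ {h = zero}              _         = refl
if-≥ {y = suc y} {h = suc h} (s≤s h≤y) = if-≥ h≤y

if-<-inv : ∀ {A : Set} {x s} {a b c : A} → b ≢ c → (if x <ᵇ s then a else b) ≡ c → x < s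
if-<-inv {x = x} {s} b≢c eq with x <? s
... | yes x<s = x<s
... | no  x≮s = ⊥-elim (b≢c (trans (sym (if-≥ (≮⇒≥ x≮s))) eq))

if-≥-inv : ∀ {A : Set} {x s} {a b c : A} → a ≢ c → (if x <ᵇ s then a else b) ≡ c → s ≤ x
if-≥-inv {x = x} {s} a≢c eq with x <? s
... | yes x<s = ⊥-elim (a≢c (trans (sym (if-< x<s)) eq))
... | no  x≮s = ≮⇒≥ x≮s

if-pres : ∀ {A : Set} (P : A → Set) {a b} β → P a → P b → P (if β then a else b)
if-pres P true  pa _  = pa
if-pres P false _  pb = pb

𝟙-≢ : ∀ {a b} → a ≢ b → 𝟙 (a ≡ᵇ b) ≡ 0
𝟙-≢ {a} {b} a≢b = cong 𝟙 (dec-false (a ℕ.≟ b) a≢b)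

≡ᵇ-cancelˡ : ∀ h {a b} → (h + a ≡ᵇ h + b) ≡ (a ≡ᵇ b)
≡ᵇ-cancelˡ zero    = refl
≡ᵇ-cancelˡ (suc h) = ≡ᵇ-cancelˡ h

<-+-split : ∀ h {h' k} → k < h + h' → k < h ⊎ ∃ λ k' → k' < h' × k ≡ h + k'
<-+-split h {k = k} k<h+h' with k <? h
... | yes k<h = inj₁ k<h
... | no  k≮h = inj₂ (k ∸ h , +-cancelˡ-< h _ _ (subst (_< h + _) k≡h+[k∸h] k<h+h') , k≡h+[k∸h])
  where
  k≡h+[k∸h] : k ≡ h + (k ∸ h)
  k≡h+[k∸h] = sym (m+[n∸m]≡n (≮⇒≥ k≮h))

h+≢< : ∀ {h a k} → k < h → h + a ≢ k
h+≢< {h} k<h h+a≡k = <⇒≱ k<h (subst (h ≤_) h+a≡k (m≤m+n h _))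

<≢h+ : ∀ {h a k} → a < h → a ≢ h + k
<≢h+ a<h a≡h+k = h+≢< a<h (sym a≡h+k)

at : List ℕ → ℕ → ℕ
at []       _       = 0
at (a ∷ as) zero    = a
at (a ∷ as) (suc i) = at as i

at-≤ : ∀ {b xs} → All (_≤ b) xs → ∀ i → at xs i ≤ b
at-≤ []         i       = z≤n
at-≤ (x≤b ∷ _)  zero    = x≤b
at-≤ (_ ∷ xs≤b) (suc i) = at-≤ xs≤b i

at-injective : ∀ {xs ys} → length xs ≡ length ys → (∀ i → i < length xs → at xs i ≡ at ys i) → xs ≡ ys
at-injective {[]}     {[]}     _    _     = refl
at-injective {x ∷ xs} {y ∷ ys} |xs| xs≗ys =
  cong₂ _∷_ (xs≗ys 0 z<s) (at-injective (suc-injective |xs|) (λ i i<n → xs≗ys (suc i) (s<s i<n)))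

∑-at : ∀ (f : ℕ → ℕ) xs → ∑[ i < length xs ] f (at xs i) ≡ sum (map f xs)
∑-at f []       = refl
∑-at f (x ∷ xs) = cong (f x +_) (∑-at f xs)

∑-at-prefix : ∀ (f : ℕ → ℕ) xs ys {zs n} → xs ++ ys ≡ zs → length zs ≡ n →
              ∑[ i < n ] (if i <ᵇ length xs then f (at zs i) else 0) ≡ sum (map f xs)
∑-at-prefix f []       ys refl refl = ∑-zero (length ys) (λ _ _ → refl)
∑-at-prefix f (x ∷ xs) ys refl refl = cong (f x +_) (∑-at-prefix f xs ys refl refl)

∑-at-suffix : ∀ (f : ℕ → ℕ) xs ys {zs n} → xs ++ ys ≡ zs → length zs ≡ n →
              ∑[ i < n ] (if i <ᵇ length xs then 0 else f (at zs i)) ≡ sum (map f ys)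
∑-at-suffix f []       ys refl refl = ∑-at f ys
∑-at-suffix f (x ∷ xs) ys refl refl = ∑-at-suffix f xs ys refl refl

++-injective : ∀ {A : Set} {xs xs' ys ys' : List A} → length xs ≡ length xs' →
               xs ++ ys ≡ xs' ++ ys' → xs ≡ xs' × ys ≡ ys'
++-injective {xs = []}     {[]}       _    eq = refl , eq
++-injective {xs = x ∷ xs} {x' ∷ xs'} |xs| eq =
  let xs≡xs' , ys≡ys' = ++-injective (suc-injective |xs|) (∷-injectiveʳ eq)
  in cong₂ _∷_ (∷-injectiveˡ eq) xs≡xs' , ys≡ys'

sum-map-suc : ∀ xs → sum (map suc xs) ≡ length xs + sum xs
sum-map-suc []       = refl
sum-map-suc (x ∷ xs) = cong suc (trans (cong (x +_) (sum-map-suc xs)) (x∙yz≈y∙xz x (length xs) (sum xs)))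

sum-map-∸ : ∀ {c xs} → All (_≤ c) xs → sum (map (c ∸_) xs) + sum xs ≡ c * length xs
sum-map-∸ {c} []                   = sym (*-zeroʳ c)
sum-map-∸ {c} {x ∷ xs} (x≤c ∷ xs≤c) = begin
  (c ∸ x + sum (map (c ∸_) xs)) + (x + sum xs) ≡⟨ interchange (c ∸ x) _ x _ ⟩
  (c ∸ x + x) + (sum (map (c ∸_) xs) + sum xs) ≡⟨ cong₂ _+_ (m∸n+n≡m x≤c) (sum-map-∸ xs≤c) ⟩
  c + c * length xs                            ≡⟨ *-suc c (length xs) ⟨
  c * suc (length xs)                          ∎
  where open ≡-Reasoning

sum-replicate : ∀ k x → sum (replicate k x) ≡ k * x
sum-replicate zero    x = refl
sum-replicate (suc k) x = cong (x +_) (sum-replicate k x)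

-- Paths and combs

Between : ℕ → ℕ → ℕ → Set
Between a b z = (a ≤ z × z ≤ b) ⊎ (b ≤ z × z ≤ a)

Between-right : ∀ a b → Between a b b
Between-right a b with ≤-total a b
... | inj₁ a≤b = inj₁ (a≤b , ≤-refl)
... | inj₂ b≤a = inj₂ (≤-refl , b≤a)

Between-≤ : ∀ {a b z} → a ≤ b → Between a b z → a ≤ z × z ≤ b
Between-≤ a≤b (inj₁ a≤z≤b)       = a≤z≤b
Between-≤ a≤b (inj₂ (b≤z , z≤a)) = ≤-trans a≤b b≤z , ≤-trans z≤a a≤b

Between-cancelˡ : ∀ h {a b z} → Between (h + a) (h + b) (h + z) → Between a b z
Between-cancelˡ h (inj₁ (l , u)) = inj₁ (+-cancelˡ-≤ h _ _ l , +-cancelˡ-≤ h _ _ u)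
Between-cancelˡ h (inj₂ (l , u)) = inj₂ (+-cancelˡ-≤ h _ _ l , +-cancelˡ-≤ h _ _ u)

Convex : (ℕ → Set) → Set
Convex P = ∀ {a b z} → P a → P b → Between a b z → P z

Convex-< : ∀ h → Convex (_< h)
Convex-< h _   b<h (inj₁ (_ , z≤b)) = ≤-<-trans z≤b b<h
Convex-< h a<h _   (inj₂ (_ , z≤a)) = ≤-<-trans z≤a a<h

Convex-≥ : ∀ h → Convex (h ≤_)
Convex-≥ h h≤a _   (inj₁ (a≤z , _)) = ≤-trans h≤a a≤z
Convex-≥ h _   h≤b (inj₂ (b≤z , _)) = ≤-trans h≤b b≤z

Convex-if-< : ∀ {A : Set} s {a b : A} → b ≢ a → Convex (λ x → (if x <ᵇ s then a else b) ≡ a)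
Convex-if-< s b≢a ea eb z∈ab = if-< (Convex-< s (if-<-inv b≢a ea) (if-<-inv b≢a eb) z∈ab)

Convex-if-≥ : ∀ {A : Set} s {a b : A} → a ≢ b → Convex (λ x → (if x <ᵇ s then a else b) ≡ b)
Convex-if-≥ s a≢b ea eb z∈ab = if-≥ (Convex-≥ s (if-≥-inv a≢b ea) (if-≥-inv a≢b eb) z∈ab)

module _ {n : ℕ} {P : Cell n → Set} where

  path-head : ∀ {c d} → PathIn P c d → P c
  path-head (here pc)     = pc
  path-head (step pc _ _) = pc

  path-trans : ∀ {c d e} → PathIn P c d → PathIn P d e → PathIn P c e
  path-trans (here _)        q = q
  path-trans (step pc c~d p) q = step pc c~d (path-trans p q)

  path-sym : ∀ {c d} → PathIn P c d → PathIn P d c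
  path-sym (here pc)       = here pc
  path-sym (step pc c~d p) = path-trans (path-sym p) (step (path-head p) (Adj-sym c~d) (here pc))
    where
    Adj-sym : ∀ {c d : Cell n} → Adj c d → Adj d c
    Adj-sym (inj₁ (i≡i' , j~j')) = inj₁ (sym i≡i' , Sum.swap j~j')
    Adj-sym (inj₂ (j≡j' , i~i')) = inj₂ (sym j≡j' , Sum.swap i~i')

  column-path-≤ : ∀ x d (y y' : Fin n) → d + toℕ y ≡ toℕ y' →
                  (∀ z → toℕ y ≤ toℕ z → toℕ z ≤ toℕ y' → P (x , z)) → PathIn P (x , y) (x , y')
  column-path-≤ x zero    y y' y≡y' P[x,-] =
    subst (λ w → PathIn P (x , y) (x , w)) (toℕ-injective y≡y') (here (P[x,-] y ≤-refl (≤-reflexive y≡y')))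
  column-path-≤ x (suc d) y y' d+1+y≡y' P[x,-] =
    step (P[x,-] y ≤-refl (<⇒≤ y<y')) (inj₁ (refl , inj₁ y+1≡y₁)) (column-path-≤ x d y₁ y' d+y₁≡y' P[x,y₁-])
    where
    y<y' : toℕ y < toℕ y'
    y<y' = ≤-trans (s≤s (m≤n+m (toℕ y) d)) (≤-reflexive d+1+y≡y')
    y+1<n : suc (toℕ y) < n
    y+1<n = ≤-<-trans y<y' (toℕ<n y')
    y₁ : Fin n
    y₁ = fromℕ< y+1<n
    y+1≡y₁ : suc (toℕ y) ≡ toℕ y₁
    y+1≡y₁ = sym (toℕ-fromℕ< y+1<n)
    d+y₁≡y' : d + toℕ y₁ ≡ toℕ y'
    d+y₁≡y' = trans (cong (d +_) (sym y+1≡y₁)) (trans (+-suc d (toℕ y)) d+1+y≡y')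
    P[x,y₁-] : ∀ z → toℕ y₁ ≤ toℕ z → toℕ z ≤ toℕ y' → P (x , z)
    P[x,y₁-] z y₁≤z = P[x,-] z (≤-trans (n≤1+n _) (subst (_≤ toℕ z) (sym y+1≡y₁) y₁≤z))

  column-path : ∀ x (y y' : Fin n) → (∀ z → Between (toℕ y) (toℕ y') (toℕ z) → P (x , z)) →
                PathIn P (x , y) (x , y')
  column-path x y y' P[x,-] with ≤-total (toℕ y) (toℕ y')
  ... | inj₁ y≤y' = column-path-≤ x _ y y' (m∸n+n≡m y≤y') (λ z l u → P[x,-] z (inj₁ (l , u)))
  ... | inj₂ y'≤y = path-sym (column-path-≤ x _ y' y (m∸n+n≡m y'≤y) (λ z l u → P[x,-] z (inj₂ (l , u))))

path-map : ∀ {n} {P Q : Cell n → Set} → (∀ {c} → P c → Q c) → ∀ {c d} → PathIn P c d → PathIn Q c d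
path-map P⇒Q (here pc)       = here (P⇒Q pc)
path-map P⇒Q (step pc c~d p) = step (P⇒Q pc) c~d (path-map P⇒Q p)

path-transpose : ∀ {n} {P : Cell n → Set} {c d} →
                 PathIn P c d → PathIn (P ∘ Product.swap) (Product.swap c) (Product.swap d)
path-transpose (here pc)       = here pc
path-transpose (step pc c~d p) = step pc (Sum.swap c~d) (path-transpose p)

row-path : ∀ {n} {P : Cell n → Set} y (x x' : Fin n) →
           (∀ z → Between (toℕ x) (toℕ x') (toℕ z) → P (z , y)) → PathIn P (x , y) (x' , y)
row-path {P = P} y x x' P[-,y] = path-transpose (column-path {P = P ∘ Product.swap} y x x' P[-,y])

record Comb (Q : ℕ → ℕ → Set) (r : ℕ) : Set where
  field
    column : ∀ {x y z} → Q x y → Between y r z → Q x z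
    spine  : Convex (λ x → Q x r)

Comb-map : ∀ {P Q : ℕ → ℕ → Set} {r} → (∀ {x y} → P x y → Q x y) → (∀ {x y} → Q x y → P x y) →
           Comb P r → Comb Q r
Comb-map P⇒Q Q⇒P comb = record
  { column = λ q z∈[y,r] → P⇒Q (column (Q⇒P q) z∈[y,r])
  ; spine  = λ qa qb z∈[a,b] → P⇒Q (spine (Q⇒P qa) (Q⇒P qb) z∈[a,b])
  }
  where open Comb comb

Shift : ℕ → (ℕ → ℕ → Set) → ℕ → ℕ → Set
Shift h Q x y = ∃ λ y' → y ≡ h + y' × Q x y'

Comb-shift : ∀ h {Q r} → Comb Q r → Comb (Shift h Q) (h + r)
Comb-shift h {Q} {r} comb = record { column = column′ ; spine = spine′ }
  where
  open Comb comb
  column′ : ∀ {x y z} → Shift h Q x y → Between y (h + r) z → Shift h Q x z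
  column′ {z = z} (y' , refl , q) z∈[y,h+r] =
    z ∸ h , z≡h+[z∸h] , column q (Between-cancelˡ h (subst (Between _ _) z≡h+[z∸h] z∈[y,h+r]))
    where
    z≡h+[z∸h] : z ≡ h + (z ∸ h)
    z≡h+[z∸h] = sym (m+[n∸m]≡n (Convex-≥ h (m≤m+n h y') (m≤m+n h r) z∈[y,h+r]))
  onSpine : ∀ {x} → Shift h Q x (h + r) → Q x r
  onSpine (y' , h+r≡h+y' , q) = subst (Q _) (sym (+-cancelˡ-≡ h _ _ h+r≡h+y')) q
  spine′ : Convex (λ x → Shift h Q x (h + r))
  spine′ qa qb z∈[a,b] = r , refl , spine (onSpine qa) (onSpine qb) z∈[a,b]

OnCells : ∀ {a} {A : Set a} {n} → (ℕ → ℕ → A) → Cell n → A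
OnCells Q (x , y) = Q (toℕ x) (toℕ y)

comb-path : ∀ {n Q} (ρ : Fin n) → Comb Q (toℕ ρ) → ∀ {c d} → OnCells Q c → OnCells Q d → PathIn (OnCells Q) c d
comb-path {Q = Q} ρ comb {x , y} {x' , y'} qc qd =
  path-trans (column-path x y ρ (λ _ → column qc))
    (path-trans (row-path ρ x x' (λ _ → spine (onSpine qc) (onSpine qd)))
      (path-sym (column-path x' y' ρ (λ _ → column qd))))
  where
  open Comb comb
  onSpine : ∀ {x y} → Q x y → Q x (toℕ ρ)
  onSpine {y = y} q = column q (Between-right y (toℕ ρ))

Class : (ℕ → ℕ → ℕ) → ℕ → ℕ → ℕ → ℕ → Set
Class label h k x y = y < h × label x y ≡ k

record StripTiling (n h : ℕ) : Set where
  field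
    label  : ℕ → ℕ → ℕ
    label< : ∀ x {y} → y < h → label x y < h
    size   : ∀ {k} → k < h → ∑[ x < n ] ∑[ y < h ] 𝟙 (label x y ≡ᵇ k) ≡ n
    comb   : ∀ {k} → k < h → ∃ λ r → r < h × Comb (Class label h k) r
open StripTiling

count-cells : ∀ {n} (lab : ℕ → ℕ → ℕ) (part : Cell n → Fin n) → (∀ c → toℕ (part c) ≡ OnCells lab c) →
  ∀ k → length (filter (λ c → part c ≟ k) (allCells n)) ≡ ∑[ x < n ] ∑[ y < n ] 𝟙 (lab x y ≡ᵇ toℕ k)
count-cells {n} lab part part≡lab k = begin
  length (filter (λ c → part c ≟ k) (allCells n))
    ≡⟨ length-filter (λ c → part c ≟ k) (allCells n) ⟩
  sum (map (λ c → 𝟙 (does (part c ≟ k))) (allCells n))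
    ≡⟨ sum-map-cartesianProduct _ (allFin n) (allFin n) ⟩
  sum (map (λ x → sum (map (λ y → 𝟙 (does (part (x , y) ≟ k))) (allFin n))) (allFin n))
    ≡⟨ cong sum (map-cong (λ x → trans (cong sum (map-cong (λ y → cong 𝟙 (same-does (x , y))) (allFin n)))
                                       (sum-map-allFin n _)) (allFin n)) ⟩
  sum (map (λ x → ∑[ y < n ] 𝟙 (lab (toℕ x) y ≡ᵇ toℕ k)) (allFin n))
    ≡⟨ sum-map-allFin n _ ⟩
  ∑[ x < n ] ∑[ y < n ] 𝟙 (lab x y ≡ᵇ toℕ k) ∎
  where
  open ≡-Reasoning
  same-does : ∀ c → does (part c ≟ k) ≡ does (OnCells lab c ℕ.≟ toℕ k)
  same-does c = does-⇔ (mk⇔ (λ part≡k → trans (sym (part≡lab c)) (cong toℕ part≡k))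
                            (λ lab≡k → toℕ-injective (trans (part≡lab c) lab≡k)))
                       (part c ≟ k) (OnCells lab c ℕ.≟ toℕ k)

tilePart : ∀ {n} → StripTiling n n → Cell n → Fin n
tilePart S (x , y) = fromℕ< (label< S (toℕ x) (toℕ<n y))

toℕ-tilePart : ∀ {n} (S : StripTiling n n) c → toℕ (tilePart S c) ≡ OnCells (label S) c
toℕ-tilePart S (x , y) = toℕ-fromℕ< _

toTiling : ∀ {n} → StripTiling n n → Tiling n
toTiling {n} S = record
  { part      = tilePart S
  ; partSize  = λ k → trans (count-cells (label S) (tilePart S) (toℕ-tilePart S) k) (size S (toℕ<n k))
  ; connected = connected′
  }
  where
  connected′ : ∀ k c d → tilePart S c ≡ k → tilePart S d ≡ k → PathIn (λ e → tilePart S e ≡ k) c d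
  connected′ k c d c∈k d∈k =
    let r , r<n , comb-k = comb S (toℕ<n k)
        comb-k′ = subst (Comb _) (sym (toℕ-fromℕ< r<n)) comb-k
    in path-map fromClass (comb-path (fromℕ< r<n) comb-k′ (toClass c∈k) (toClass d∈k))
    where
    toClass : ∀ {e} → tilePart S e ≡ k → OnCells (Class (label S) n (toℕ k)) e
    toClass {e} e∈k = toℕ<n (proj₂ e) , trans (sym (toℕ-tilePart S e)) (cong toℕ e∈k)
    fromClass : ∀ {e} → OnCells (Class (label S) n (toℕ k)) e → tilePart S e ≡ k
    fromClass {e} e∈k = toℕ-injective (trans (toℕ-tilePart S e) (proj₂ e∈k))

resize : ∀ {n h h'} → h ≡ h' → StripTiling n h → StripTiling n h'
resize refl S = S

ColumnRefines : ℕ → ℕ → (ℕ → ℕ → ℕ) → (ℕ → ℕ → ℕ) → Set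
ColumnRefines n h l l' = ∀ {x y y'} → x < n → y < h → y' < h → l x y ≡ l x y' → l' x y ≡ l' x y'

samePartition⇒columnRefines : ∀ {n h} (h≡n : h ≡ n) {S S' : StripTiling n h} →
  SamePartition (toTiling (resize h≡n S)) (toTiling (resize h≡n S')) → ColumnRefines n h (label S) (label S')
samePartition⇒columnRefines refl {S} {S'} same x<n y<n y'<n eq =
  trans (sym (toℕ-tilePart-fromℕ< S' x<n y<n))
    (trans (cong toℕ (Equivalence.to (same _ _) (toℕ-injective
              (trans (toℕ-tilePart-fromℕ< S x<n y<n) (trans eq (sym (toℕ-tilePart-fromℕ< S x<n y'<n)))))))
      (toℕ-tilePart-fromℕ< S' x<n y'<n))
  where
  toℕ-tilePart-fromℕ< : ∀ {n} (S : StripTiling n n) {x y} (x<n : x < n) (y<n : y < n) →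
                        toℕ (tilePart S (fromℕ< x<n , fromℕ< y<n)) ≡ label S x y
  toℕ-tilePart-fromℕ< S x<n y<n = trans (toℕ-tilePart S _) (cong₂ (label S) (toℕ-fromℕ< x<n) (toℕ-fromℕ< y<n))

emptyStrip : ∀ {n} → StripTiling n 0
emptyStrip = record { label = λ _ _ → 0 ; label< = λ _ () ; size = λ () ; comb = λ () }

row : ∀ {n} → StripTiling n 1
row {n} = record
  { label  = λ _ _ → 0
  ; label< = λ _ _ → z<s
  ; size   = λ { z<s → ∑-one n }
  ; comb   = λ { z<s → 0 , z<s , record { column = λ { (y<1 , refl) z∈[y,0] → Convex-< 1 y<1 z<s z∈[y,0] , refl }
                                          ; spine  = λ _ _ _ → z<s , refl } }
  }

stackLabel : ℕ → (ℕ → ℕ → ℕ) → (ℕ → ℕ → ℕ) → ℕ → ℕ → ℕ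
stackLabel h upper lower x y = if y <ᵇ h then upper x y else h + lower x (y ∸ h)

stackLabel-< : ∀ {h} upper lower {x y} → y < h → stackLabel h upper lower x y ≡ upper x y
stackLabel-< upper lower = if-<

stackLabel-+ : ∀ {h} upper lower x y → stackLabel h upper lower x (h + y) ≡ h + lower x y
stackLabel-+ {h} upper lower x y = trans (if-≥ (m≤m+n h y)) (cong (λ y' → h + lower x y') (m+n∸m≡n h y))

stack : ∀ {n h h'} → StripTiling n h → StripTiling n h' → StripTiling n (h + h')
stack {n} {h} {h'} S S' = record { label = st ; label< = label<′ ; size = size′ ; comb = comb′ }
  where
  st : ℕ → ℕ → ℕ
  st = stackLabel h (label S) (label S')
  st-< : ∀ {x y} → y < h → st x y ≡ label S x y
  st-< = stackLabel-< (label S) (label S')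
  st-+ : ∀ x y → st x (h + y) ≡ h + label S' x y
  st-+ = stackLabel-+ (label S) (label S')

  label<′ : ∀ x {y} → y < h + h' → st x y < h + h'
  label<′ x y<h+h' with <-+-split h y<h+h'
  ... | inj₁ y<h                 = subst (_< h + h') (sym (st-< y<h)) (≤-trans (label< S x y<h) (m≤m+n h h'))
  ... | inj₂ (y' , y'<h' , refl) = subst (_< h + h') (sym (st-+ x y')) (+-monoʳ-< h (label< S' x y'<h'))

  column-split : ∀ k x → ∑[ y < h + h' ] 𝟙 (st x y ≡ᵇ k) ≡
                         ∑[ y < h ] 𝟙 (label S x y ≡ᵇ k) + ∑[ y < h' ] 𝟙 (h + label S' x y ≡ᵇ k)
  column-split k x = trans (∑-split h h' _)
    (cong₂ _+_ (∑-cong h (λ y y<h → cong (λ l → 𝟙 (l ≡ᵇ k)) (st-< y<h)))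
               (∑-cong h' (λ y _ → cong (λ l → 𝟙 (l ≡ᵇ k)) (st-+ x y))))

  size′ : ∀ {k} → k < h + h' → ∑[ x < n ] ∑[ y < h + h' ] 𝟙 (st x y ≡ᵇ k) ≡ n
  size′ {k} k<h+h' = trans (∑-cong n (λ x _ → column-split k x)) (trans (∑-+ n _ _) (by-part (<-+-split h k<h+h')))
    where
    by-part : k < h ⊎ (∃ λ k' → k' < h' × k ≡ h + k') →
              ∑[ x < n ] ∑[ y < h ] 𝟙 (label S x y ≡ᵇ k) +
              ∑[ x < n ] ∑[ y < h' ] 𝟙 (h + label S' x y ≡ᵇ k) ≡ n
    by-part (inj₁ k<h) =
      trans (cong₂ _+_ (size S k<h) (∑-zero n (λ x _ → ∑-zero h' (λ y _ → 𝟙-≢ (h+≢< k<h))))) (+-identityʳ n)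
    by-part (inj₂ (k' , k'<h' , refl)) =
      cong₂ _+_ (∑-zero n (λ x _ → ∑-zero h (λ y y<h → 𝟙-≢ (<≢h+ (label< S x y<h)))))
                (trans (∑-cong n (λ x _ → ∑-cong h' (λ y _ → cong 𝟙 (≡ᵇ-cancelˡ h)))) (size S' k'<h'))

  comb′ : ∀ {k} → k < h + h' → ∃ λ r → r < h + h' × Comb (Class st (h + h') k) r
  comb′ k<h+h' with <-+-split h k<h+h'
  ... | inj₁ k<h =
    let r , r<h , comb-k = comb S k<h
    in r , ≤-trans r<h (m≤m+n h h') , Comb-map fromUpper toUpper comb-k
    where
    fromUpper : ∀ {x y} → Class (label S) h _ x y → Class st (h + h') _ x y
    fromUpper (y<h , eq) = ≤-trans y<h (m≤m+n h h') , trans (st-< y<h) eq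
    toUpper : ∀ {x y} → Class st (h + h') _ x y → Class (label S) h _ x y
    toUpper {x} (y<h+h' , eq) with <-+-split h y<h+h'
    ... | inj₁ y<h             = y<h , trans (sym (st-< y<h)) eq
    ... | inj₂ (y' , _ , refl) = ⊥-elim (h+≢< k<h (trans (sym (st-+ x y')) eq))
  ... | inj₂ (k' , k'<h' , refl) =
    let r , r<h' , comb-k' = comb S' k'<h'
    in h + r , +-monoʳ-< h r<h' , Comb-map fromLower toLower (Comb-shift h comb-k')
    where
    fromLower : ∀ {x y} → Shift h (Class (label S') h' k') x y → Class st (h + h') (h + k') x y
    fromLower {x} (y' , refl , y'<h' , eq) = +-monoʳ-< h y'<h' , trans (st-+ x y') (cong (h +_) eq)
    toLower : ∀ {x y} → Class st (h + h') (h + k') x y → Shift h (Class (label S') h' k') x y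
    toLower {x} (y<h+h' , eq) with <-+-split h y<h+h'
    ... | inj₁ y<h                 = ⊥-elim (<≢h+ (label< S x y<h) (trans (sym (st-< y<h)) eq))
    ... | inj₂ (y' , y'<h' , refl) = y' , refl , y'<h' , +-cancelˡ-≡ h _ _ (trans (sym (st-+ x y')) eq)

stackAll : ∀ {n h q} → Vec (StripTiling n h) q → StripTiling n (q * h)
stackAll []       = emptyStrip
stackAll (S ∷ Ss) = stack S (stackAll Ss)

rows : ∀ {n} h → StripTiling n h
rows h = resize (*-identityʳ h) (stackAll (Vec.replicate h row))

module _ {n h h'} (S S' : StripTiling n h) (T T' : StripTiling n h')
         (refines : ColumnRefines n (h + h') (label (stack S T)) (label (stack S' T'))) where

  stack-refinesˡ : ColumnRefines n h (label S) (label S')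
  stack-refinesˡ {x} {y} {y'} x<n y<h y'<h eq = begin
    label S' x y                            ≡⟨ stackLabel-< (label S') (label T') y<h ⟨
    stackLabel h (label S') (label T') x y  ≡⟨ refines x<n (<h+h' y<h) (<h+h' y'<h) upper-eq ⟩
    stackLabel h (label S') (label T') x y' ≡⟨ stackLabel-< (label S') (label T') y'<h ⟩
    label S' x y'                           ∎
    where
    open ≡-Reasoning
    <h+h' : ∀ {z} → z < h → z < h + h'
    <h+h' z<h = ≤-trans z<h (m≤m+n h h')
    upper-eq : stackLabel h (label S) (label T) x y ≡ stackLabel h (label S) (label T) x y'
    upper-eq = trans (stackLabel-< (label S) (label T) y<h) (trans eq (sym (stackLabel-< (label S) (label T) y'<h)))

  stack-refinesʳ : ColumnRefines n h' (label T) (label T')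
  stack-refinesʳ {x} {y} {y'} x<n y<h' y'<h' eq = +-cancelˡ-≡ h _ _ (begin
    h + label T' x y                              ≡⟨ stackLabel-+ (label S') (label T') x y ⟨
    stackLabel h (label S') (label T') x (h + y)  ≡⟨ refines x<n (+-monoʳ-< h y<h') (+-monoʳ-< h y'<h') lower-eq ⟩
    stackLabel h (label S') (label T') x (h + y') ≡⟨ stackLabel-+ (label S') (label T') x y' ⟩
    h + label T' x y'                             ∎)
    where
    open ≡-Reasoning
    lower-eq : stackLabel h (label S) (label T) x (h + y) ≡ stackLabel h (label S) (label T) x (h + y')
    lower-eq = trans (stackLabel-+ (label S) (label T) x y)
                 (trans (cong (h +_) eq) (sym (stackLabel-+ (label S) (label T) x y')))

-- Bands

-- A band column with tooth τ: the rows y ≤ τ belong to the upper tile 0 (left) or 2 (right),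
-- the rows y > τ to the lower tile 1 (left) or 3 (right).
bandColumn : Bool → Bool → ℕ → ℕ → ℕ
bandColumn left₁ left₂ τ y = if τ <ᵇ y then (if left₂ then 1 else 3) else (if left₁ then 0 else 2)

ColumnSizes : Bool → Bool → ℕ → Set
ColumnSizes a b τ = let size k = ∑[ y < 4 ] 𝟙 (bandColumn a b τ y ≡ᵇ k) in
  size 0 ≡ (if a then suc τ else 0) × size 1 ≡ (if b then 3 ∸ τ else 0) ×
  size 2 ≡ (if a then 0 else suc τ) × size 3 ≡ (if b then 0 else 3 ∸ τ)

bandColumn-size : ∀ a b τ → τ ≤ 2 → ColumnSizes a b τ
bandColumn-size true  true  0 _ = refl , refl , refl , refl
bandColumn-size true  true  1 _ = refl , refl , refl , refl
bandColumn-size true  true  2 _ = refl , refl , refl , refl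
bandColumn-size true  false 0 _ = refl , refl , refl , refl
bandColumn-size true  false 1 _ = refl , refl , refl , refl
bandColumn-size true  false 2 _ = refl , refl , refl , refl
bandColumn-size false true  0 _ = refl , refl , refl , refl
bandColumn-size false true  1 _ = refl , refl , refl , refl
bandColumn-size false true  2 _ = refl , refl , refl , refl
bandColumn-size false false 0 _ = refl , refl , refl , refl
bandColumn-size false false 1 _ = refl , refl , refl , refl
bandColumn-size false false 2 _ = refl , refl , refl , refl
bandColumn-size _     _     (suc (suc (suc _))) (s≤s (s≤s ()))

-- The upper tiles are separated between `left` and `middle`, the lower ones between `middle`
-- and `right`; the four sums are the sizes of the tiles.
record BandTeeth (n : ℕ) : Set where
  field
    left middle right : List ℕ
    length≡     : length (left ++ middle ++ right) ≡ n
    teeth≤2     : All (_≤ 2) (left ++ middle ++ right)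
    upper-left  : sum (map suc left) ≡ n
    upper-right : sum (map suc (middle ++ right)) ≡ n
    lower-left  : sum (map (3 ∸_) (left ++ middle)) ≡ n
    lower-right : sum (map (3 ∸_) right) ≡ n

  teeth : List ℕ
  teeth = left ++ middle ++ right

  tooth : ℕ → ℕ
  tooth = at teeth

  upperTile : ℕ → ℕ
  upperTile x = if x <ᵇ length left then 0 else 2

  lowerTile : ℕ → ℕ
  lowerTile x = if x <ᵇ length (left ++ middle) then 1 else 3

  bandLabel : ℕ → ℕ → ℕ
  bandLabel x y = bandColumn (x <ᵇ length left) (x <ᵇ length (left ++ middle)) (tooth x) y

module _ {n} (B : BandTeeth n) where
  open BandTeeth B

  tooth≤2 : ∀ x → tooth x ≤ 2
  tooth≤2 = at-≤ teeth≤2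

  bandLabel-upper : ∀ {x y} → y ≤ tooth x → bandLabel x y ≡ upperTile x
  bandLabel-upper = if-≥

  bandLabel-lower : ∀ {x y} → tooth x < y → bandLabel x y ≡ lowerTile x
  bandLabel-lower = if-<

  lowerTile≢ : ∀ {k} → k ≢ 1 → k ≢ 3 → ∀ x → lowerTile x ≢ k
  lowerTile≢ k≢1 k≢3 x = if-pres (_≢ _) {1} {3} (x <ᵇ length (left ++ middle)) (k≢1 ∘ sym) (k≢3 ∘ sym)

  upperTile≢ : ∀ {k} → k ≢ 0 → k ≢ 2 → ∀ x → upperTile x ≢ k
  upperTile≢ k≢0 k≢2 x = if-pres (_≢ _) {0} {2} (x <ᵇ length left) (k≢0 ∘ sym) (k≢2 ∘ sym)

  upper≢lower : ∀ x x' → upperTile x ≢ lowerTile x'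
  upper≢lower x x' eq = lowerTile≢ (upperTile≢ (λ ()) (λ ()) x) (upperTile≢ (λ ()) (λ ()) x) x' (sym eq)

  upper-comb : ∀ {k} → (∀ x → lowerTile x ≢ k) → Convex (λ x → upperTile x ≡ k) → Comb (Class bandLabel 4 k) 0
  upper-comb {k} lower≢k convex = record { column = column′ ; spine = spine′ }
    where
    column′ : ∀ {x y z} → Class bandLabel 4 k x y → Between y 0 z → Class bandLabel 4 k x z
    column′ {x} {y} {z} (y<4 , eq) z∈[y,0] =
      ≤-<-trans z≤y y<4 , trans (bandLabel-upper (≤-trans z≤y y≤t)) (trans (sym (bandLabel-upper y≤t)) eq)
      where
      y≤t : y ≤ tooth x
      y≤t = ≮⇒≥ (λ t<y → lower≢k x (trans (sym (bandLabel-lower t<y)) eq))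
      z≤y : z ≤ y
      z≤y = proj₂ (Between-≤ z≤n (Sum.swap z∈[y,0]))
    onSpine : ∀ {x} → bandLabel x 0 ≡ k → upperTile x ≡ k
    onSpine = trans (sym (bandLabel-upper z≤n))
    spine′ : Convex (λ x → Class bandLabel 4 k x 0)
    spine′ (_ , ea) (_ , eb) z∈[a,b] = z<s , trans (bandLabel-upper z≤n) (convex (onSpine ea) (onSpine eb) z∈[a,b])

  lower-comb : ∀ {k} → (∀ x → upperTile x ≢ k) → Convex (λ x → lowerTile x ≡ k) → Comb (Class bandLabel 4 k) 3
  lower-comb {k} upper≢k convex = record { column = column′ ; spine = spine′ }
    where
    column′ : ∀ {x y z} → Class bandLabel 4 k x y → Between y 3 z → Class bandLabel 4 k x z
    column′ {x} {y} {z} (y<4 , eq) z∈[y,3] =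
      s≤s z≤3 , trans (bandLabel-lower (<-≤-trans t<y y≤z)) (trans (sym (bandLabel-lower t<y)) eq)
      where
      t<y : tooth x < y
      t<y = ≰⇒> (λ y≤t → upper≢k x (trans (sym (bandLabel-upper y≤t)) eq))
      y≤z : y ≤ z
      y≤z = proj₁ (Between-≤ (s≤s⁻¹ y<4) z∈[y,3])
      z≤3 : z ≤ 3
      z≤3 = proj₂ (Between-≤ (s≤s⁻¹ y<4) z∈[y,3])
    t<3 : ∀ x → tooth x < 3
    t<3 x = s≤s (tooth≤2 x)
    onSpine : ∀ {x} → bandLabel x 3 ≡ k → lowerTile x ≡ k
    onSpine {x} = trans (sym (bandLabel-lower (t<3 x)))
    spine′ : Convex (λ x → Class bandLabel 4 k x 3)
    spine′ {z = z} (_ , ea) (_ , eb) z∈[a,b] =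
      ≤-refl , trans (bandLabel-lower (t<3 z)) (convex (onSpine ea) (onSpine eb) z∈[a,b])

  band : StripTiling n 4
  band = record { label = bandLabel ; label< = label<′ ; size = size′ ; comb = comb′ }
    where
    label<′ : ∀ x {y} → y < 4 → bandLabel x y < 4
    label<′ x {y} _ = if-pres (_< 4) (tooth x <ᵇ y) (if-pres (_< 4) {1} {3} _ (s≤s (s≤s z≤n)) ≤-refl)
                                                  (if-pres (_< 4) {0} {2} _ z<s (s≤s (s≤s (s≤s z≤n))))
    column-size : ∀ x → ColumnSizes (x <ᵇ length left) (x <ᵇ length (left ++ middle)) (tooth x)
    column-size x = bandColumn-size _ _ (tooth x) (tooth≤2 x)
    assoc : (left ++ middle) ++ right ≡ teeth
    assoc = ++-assoc left middle right
    size′ : ∀ {k} → k < 4 → ∑[ x < n ] ∑[ y < 4 ] 𝟙 (bandLabel x y ≡ᵇ k) ≡ n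
    size′ {0} _ = trans (∑-cong n (λ x _ → proj₁ (column-size x)))
                        (trans (∑-at-prefix suc left (middle ++ right) refl length≡) upper-left)
    size′ {1} _ = trans (∑-cong n (λ x _ → proj₁ (proj₂ (column-size x))))
                        (trans (∑-at-prefix (3 ∸_) (left ++ middle) right assoc length≡) lower-left)
    size′ {2} _ = trans (∑-cong n (λ x _ → proj₁ (proj₂ (proj₂ (column-size x)))))
                        (trans (∑-at-suffix suc left (middle ++ right) refl length≡) upper-right)
    size′ {3} _ = trans (∑-cong n (λ x _ → proj₂ (proj₂ (proj₂ (column-size x)))))
                        (trans (∑-at-suffix (3 ∸_) (left ++ middle) right assoc length≡) lower-right)
    size′ {suc (suc (suc (suc _)))} (s≤s (s≤s (s≤s (s≤s ()))))
    comb′ : ∀ {k} → k < 4 → ∃ λ r → r < 4 × Comb (Class bandLabel 4 k) r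
    comb′ {0} _ = 0 , z<s    , upper-comb (lowerTile≢ (λ ()) (λ ())) (Convex-if-< (length left) (λ ()))
    comb′ {1} _ = 3 , ≤-refl , lower-comb (upperTile≢ (λ ()) (λ ())) (Convex-if-< (length (left ++ middle)) (λ ()))
    comb′ {2} _ = 0 , z<s    , upper-comb (lowerTile≢ (λ ()) (λ ())) (Convex-if-≥ (length left) (λ ()))
    comb′ {3} _ = 3 , ≤-refl , lower-comb (upperTile≢ (λ ()) (λ ())) (Convex-if-≥ (length (left ++ middle)) (λ ()))
    comb′ {suc (suc (suc (suc _)))} (s≤s (s≤s (s≤s (s≤s ()))))

  below-tooth⇔same-tile : ∀ {x y} → y ≤ tooth x ⇔ bandLabel x 0 ≡ bandLabel x y
  below-tooth⇔same-tile {x} = mk⇔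
    (λ y≤t → trans (bandLabel-upper z≤n) (sym (bandLabel-upper y≤t)))
    (λ same → ≮⇒≥ (λ t<y → upper≢lower x x (trans (sym (bandLabel-upper z≤n)) (trans same (bandLabel-lower t<y)))))

band-teeth-injective : ∀ {n} (B B' : BandTeeth n) →
  ColumnRefines n 4 (label (band B)) (label (band B')) → ColumnRefines n 4 (label (band B')) (label (band B)) →
  BandTeeth.teeth B ≡ BandTeeth.teeth B'
band-teeth-injective {n} B B' B⊑B' B'⊑B =
  at-injective (trans (BandTeeth.length≡ B) (sym (BandTeeth.length≡ B')))
    (λ x x<len → let x<n = subst (x <_) (BandTeeth.length≡ B) x<len
                 in ≤-antisym (tooth≤ B B' B⊑B' x<n) (tooth≤ B' B B'⊑B x<n))
  where
  tooth≤ : ∀ B B' → ColumnRefines n 4 (label (band B)) (label (band B')) →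
           ∀ {x} → x < n → BandTeeth.tooth B x ≤ BandTeeth.tooth B' x
  tooth≤ B B' B⊑B' {x} x<n =
    Equivalence.from (below-tooth⇔same-tile B')
      (B⊑B' x<n z<s (s≤s (≤-trans (tooth≤2 B x) (n≤1+n 2))) (Equivalence.to (below-tooth⇔same-tile B) ≤-refl))

mkBandTeeth : ∀ {n m p} (X M Y : List ℕ) → n ≡ m + (p + m) →
  length X ≡ m → sum X ≡ m + p → length M ≡ p → sum M ≡ p → length Y ≡ m → sum Y + p ≡ m →
  All (_≤ 2) X → All (_≤ 2) M → All (_≤ 2) Y → BandTeeth n
mkBandTeeth {n} {m} {p} X M Y n≡ |X| ΣX |M| ΣM |Y| ΣY+p X≤2 M≤2 Y≤2 = record
  { left = X ; middle = M ; right = Y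
  ; length≡     = begin
      length (X ++ M ++ Y)             ≡⟨ length-++ X ⟩
      length X + length (M ++ Y)       ≡⟨ cong (length X +_) (length-++ M) ⟩
      length X + (length M + length Y) ≡⟨ cong₂ _+_ |X| (cong₂ _+_ |M| |Y|) ⟩
      m + (p + m)                      ≡⟨ n≡ ⟨
      n                                ∎
  ; teeth≤2     = ++⁺ X≤2 (++⁺ M≤2 Y≤2)
  ; upper-left  = begin
      sum (map suc X)                  ≡⟨ sum-map-suc X ⟩
      length X + sum X                 ≡⟨ cong₂ _+_ |X| ΣX ⟩
      m + (m + p)                      ≡⟨ cong (m +_) (+-comm m p) ⟩
      m + (p + m)                      ≡⟨ n≡ ⟨
      n                                ∎
  ; upper-right = begin
      sum (map suc (M ++ Y))                  ≡⟨ sum-map-suc (M ++ Y) ⟩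
      length (M ++ Y) + sum (M ++ Y)          ≡⟨ cong₂ _+_ (length-++ M) (sum-++ M Y) ⟩
      (length M + length Y) + (sum M + sum Y) ≡⟨ cong₂ _+_ (cong₂ _+_ |M| |Y|) (cong (_+ sum Y) ΣM) ⟩
      (p + m) + (p + sum Y)                   ≡⟨ cong ((p + m) +_) (trans (+-comm p (sum Y)) ΣY+p) ⟩
      (p + m) + m                             ≡⟨ +-comm (p + m) m ⟩
      m + (p + m)                             ≡⟨ n≡ ⟨
      n                                       ∎
  ; lower-left  = +-cancelʳ-≡ (sum (X ++ M)) _ _ (begin
      sum (map (3 ∸_) (X ++ M)) + sum (X ++ M) ≡⟨ sum-map-∸ (++⁺ (≤2⇒≤3 X≤2) (≤2⇒≤3 M≤2)) ⟩
      3 * length (X ++ M)                      ≡⟨ cong (3 *_) (trans (length-++ X) (cong₂ _+_ |X| |M|)) ⟩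
      3 * (m + p)                              ≡⟨ lower-left-identity m p ⟩
      m + (p + m) + (m + p + p)                ≡⟨ cong₂ _+_ n≡ (trans (sum-++ X M) (cong₂ _+_ ΣX ΣM)) ⟨
      n + sum (X ++ M)                         ∎)
  ; lower-right = +-cancelʳ-≡ (sum Y) _ _ (begin
      sum (map (3 ∸_) Y) + sum Y               ≡⟨ sum-map-∸ (≤2⇒≤3 Y≤2) ⟩
      3 * length Y                             ≡⟨ cong (3 *_) (trans |Y| (sym ΣY+p)) ⟩
      3 * (sum Y + p)                          ≡⟨ lower-right-identity (sum Y) p ⟩
      (sum Y + p) + (p + (sum Y + p)) + sum Y  ≡⟨ cong (_+ sum Y) (trans (cong (λ m → m + (p + m)) ΣY+p) (sym n≡)) ⟩
      n + sum Y                                ∎)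
  }
  where
  open ≡-Reasoning
  ≤2⇒≤3 : ∀ {xs} → All (_≤ 2) xs → All (_≤ 3) xs
  ≤2⇒≤3 = All.map (λ x≤2 → ≤-trans x≤2 (n≤1+n 2))
  lower-left-identity : ∀ m p → 3 * (m + p) ≡ m + (p + m) + (m + p + p)
  lower-left-identity = solve-∀
  lower-right-identity : ∀ s p → 3 * (s + p) ≡ (s + p) + (p + (s + p)) + s
  lower-right-identity = solve-∀

words : Vec (List ℕ) 19
words = (0 ∷ 0 ∷ 2 ∷ 2 ∷ []) ∷ (0 ∷ 1 ∷ 1 ∷ 2 ∷ []) ∷ (0 ∷ 1 ∷ 2 ∷ 1 ∷ []) ∷ (0 ∷ 2 ∷ 0 ∷ 2 ∷ []) ∷
        (0 ∷ 2 ∷ 1 ∷ 1 ∷ []) ∷ (0 ∷ 2 ∷ 2 ∷ 0 ∷ []) ∷ (1 ∷ 0 ∷ 1 ∷ 2 ∷ []) ∷ (1 ∷ 0 ∷ 2 ∷ 1 ∷ []) ∷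
        (1 ∷ 1 ∷ 0 ∷ 2 ∷ []) ∷ (1 ∷ 1 ∷ 1 ∷ 1 ∷ []) ∷ (1 ∷ 1 ∷ 2 ∷ 0 ∷ []) ∷ (1 ∷ 2 ∷ 0 ∷ 1 ∷ []) ∷
        (1 ∷ 2 ∷ 1 ∷ 0 ∷ []) ∷ (2 ∷ 0 ∷ 0 ∷ 2 ∷ []) ∷ (2 ∷ 0 ∷ 1 ∷ 1 ∷ []) ∷ (2 ∷ 0 ∷ 2 ∷ 0 ∷ []) ∷
        (2 ∷ 1 ∷ 0 ∷ 1 ∷ []) ∷ (2 ∷ 1 ∷ 1 ∷ 0 ∷ []) ∷ (2 ∷ 2 ∷ 0 ∷ 0 ∷ []) ∷ []

word : Fin 19 → List ℕ
word = Vec.lookup words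

IsWord : List ℕ → Set
IsWord w = length w ≡ 4 × sum w ≡ 4 × All (_≤ 2) w

word-isWord : ∀ k → IsWord (word k)
word-isWord = from-yes (Fin.all? λ k →
  (length (word k) ℕ.≟ 4) ×-dec (sum (word k) ℕ.≟ 4) ×-dec All.all? (_≤? 2) (word k))

word-injective : ∀ k k' → word k ≡ word k' → k ≡ k'
word-injective = from-yes (Fin.all? λ k → Fin.all? λ k' → ≡-dec ℕ._≟_ (word k) (word k') →-dec (k ≟ k'))

blocks : ∀ {u} → Vec (Fin 19) u → List ℕ
blocks []       = []
blocks (k ∷ ks) = word k ++ blocks ks

length-blocks : ∀ {u} (ks : Vec (Fin 19) u) → length (blocks ks) ≡ u * 4
length-blocks []       = refl
length-blocks (k ∷ ks) = trans (length-++ (word k)) (cong₂ _+_ (proj₁ (word-isWord k)) (length-blocks ks))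

sum-blocks : ∀ {u} (ks : Vec (Fin 19) u) → sum (blocks ks) ≡ u * 4
sum-blocks []       = refl
sum-blocks (k ∷ ks) = trans (sum-++ (word k) _) (cong₂ _+_ (proj₁ (proj₂ (word-isWord k))) (sum-blocks ks))

blocks≤2 : ∀ {u} (ks : Vec (Fin 19) u) → All (_≤ 2) (blocks ks)
blocks≤2 []       = []
blocks≤2 (k ∷ ks) = ++⁺ (proj₂ (proj₂ (word-isWord k))) (blocks≤2 ks)

blocks-injective : ∀ {u} (ks ks' : Vec (Fin 19) u) → blocks ks ≡ blocks ks' → ks ≡ ks'
blocks-injective []       []         _  = refl
blocks-injective (k ∷ ks) (k' ∷ ks') eq =
  let k≡k' , ks≡ks' = ++-injective (trans (proj₁ (word-isWord k)) (sym (proj₁ (word-isWord k')))) eq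
  in cong₂ _∷_ (word-injective k k' k≡k') (blocks-injective ks ks' ks≡ks')

length-cartesianProductWith : ∀ {A B C : Set} (g : A → B → C) xs ys →
  length (cartesianProductWith g xs ys) ≡ length xs * length ys
length-cartesianProductWith g []       ys = refl
length-cartesianProductWith g (x ∷ xs) ys =
  trans (length-++ (map (g x) ys)) (cong₂ _+_ (length-map (g x) ys) (length-cartesianProductWith g xs ys))

vectors : ∀ {A : Set} k → List A → List (Vec A k)
vectors zero    xs = [] ∷ []
vectors (suc k) xs = cartesianProductWith _∷_ xs (vectors k xs)

length-vectors : ∀ {A : Set} k (xs : List A) → length (vectors k xs) ≡ length xs ^ k
length-vectors zero    xs = refl
length-vectors (suc k) xs =
  trans (length-cartesianProductWith _∷_ xs (vectors k xs)) (cong (length xs *_) (length-vectors k xs))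

vectors-unique : ∀ {A : Set} k {xs : List A} → Unique xs → Unique (vectors k xs)
vectors-unique zero    _   = [] AllPairs.∷ AllPairs.[]
vectors-unique (suc k) xs! = Unique.cartesianProductWith⁺ _∷_ Vec.∷-injective xs! (vectors-unique k xs!)

-- n = 4q + e = 2m + p with m = 4u + f + 1: q bands and e single rows, u words in each half of a band.
record Layout (n : ℕ) : Set where
  field
    q e m p u f : ℕ
    4q+e≡n   : q * 4 + e ≡ n
    n≡m+p+m  : n ≡ m + (p + m)
    p≤1      : p ≤ 1
    m≡4u+f+1 : m ≡ suc (u * 4 + f)

module Family {n} (L : Layout n) where
  open Layout L

  Choice : Set
  Choice = Vec (Fin 19) u × Vec (Fin 19) u

  padded : Vec (Fin 19) u → List ℕ
  padded ks = blocks ks ++ replicate f 1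

  length-padded : ∀ ks → length (padded ks) ≡ u * 4 + f
  length-padded ks = trans (length-++ (blocks ks)) (cong₂ _+_ (length-blocks ks) (length-replicate f))

  sum-padded : ∀ ks → sum (padded ks) ≡ u * 4 + f
  sum-padded ks = trans (sum-++ (blocks ks) _) (cong₂ _+_ (sum-blocks ks) (trans (sum-replicate f 1) (*-identityʳ f)))

  padded≤2 : ∀ ks → All (_≤ 2) (padded ks)
  padded≤2 ks = ++⁺ (blocks≤2 ks) (replicate⁺ f (s≤s z≤n))

  -- The leading teeth 1 + p and 1 ∸ p adjust the sums of the halves to m + p and m ∸ p.
  bandTeeth : Choice → BandTeeth n
  bandTeeth (ks , ks') = mkBandTeeth (suc p ∷ padded ks) (replicate p 1) ((1 ∸ p) ∷ padded ks') n≡m+p+m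
    (trans (cong suc (length-padded ks)) (sym m≡4u+f+1))
    (trans (cong (suc p +_) (sum-padded ks)) (trans (cong suc (+-comm p _)) (cong (_+ p) (sym m≡4u+f+1))))
    (length-replicate p)
    (trans (sum-replicate p 1) (*-identityʳ p))
    (trans (cong suc (length-padded ks')) (sym m≡4u+f+1))
    (trans (cong (λ s → 1 ∸ p + s + p) (sum-padded ks')) (trans (1∸p+s+p p≤1 (u * 4 + f)) (sym m≡4u+f+1)))
    (s≤s p≤1 ∷ padded≤2 ks)
    (replicate⁺ p (s≤s z≤n))
    (≤-trans (m∸n≤m 1 p) (s≤s z≤n) ∷ padded≤2 ks')
    where
    1∸p+s+p : ∀ {p} → p ≤ 1 → ∀ s → 1 ∸ p + s + p ≡ suc s
    1∸p+s+p z≤n       s = +-identityʳ (suc s)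
    1∸p+s+p (s≤s z≤n) s = +-comm s 1

  bandTeeth-injective : ∀ c c' → BandTeeth.teeth (bandTeeth c) ≡ BandTeeth.teeth (bandTeeth c') → c ≡ c'
  bandTeeth-injective (ks , ks') (ls , ls') eq =
    let X≡X' , MY≡MY' = ++-injective (cong suc (trans (length-padded ks) (sym (length-padded ls)))) eq
        Y≡Y'          = ++-cancelˡ (replicate p 1) _ _ MY≡MY'
    in cong₂ _,_ (padded-injective ks ls (∷-injectiveʳ X≡X')) (padded-injective ks' ls' (∷-injectiveʳ Y≡Y'))
    where
    padded-injective : ∀ ks ls → padded ks ≡ padded ls → ks ≡ ls
    padded-injective ks ls eq = blocks-injective ks ls (++-cancelʳ (replicate f 1) _ _ eq)

  bands : ∀ {k} → Vec Choice k → StripTiling n (k * 4)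
  bands cs = stackAll (Vec.map (band ∘ bandTeeth) cs)

  bands-injective : ∀ {k} (cs cs' : Vec Choice k) →
    ColumnRefines n (k * 4) (label (bands cs)) (label (bands cs')) →
    ColumnRefines n (k * 4) (label (bands cs')) (label (bands cs)) → cs ≡ cs'
  bands-injective []       []         _      _      = refl
  bands-injective {suc k} (c ∷ cs) (c' ∷ cs') c∷cs⊑c'∷cs' c'∷cs'⊑c∷cs =
    cong₂ _∷_ (bandTeeth-injective c c' (band-teeth-injective B B' B⊑B' B'⊑B)) (bands-injective cs cs' cs⊑cs' cs'⊑cs)
    where
    B B' : BandTeeth n
    B  = bandTeeth c
    B' = bandTeeth c'
    B⊑B' : ColumnRefines n 4 (label (band B)) (label (band B'))
    B⊑B' = stack-refinesˡ (band B) (band B') (bands cs) (bands cs') c∷cs⊑c'∷cs'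
    B'⊑B : ColumnRefines n 4 (label (band B')) (label (band B))
    B'⊑B = stack-refinesˡ (band B') (band B) (bands cs') (bands cs) c'∷cs'⊑c∷cs
    cs⊑cs' : ColumnRefines n (k * 4) (label (bands cs)) (label (bands cs'))
    cs⊑cs' = stack-refinesʳ (band B) (band B') (bands cs) (bands cs') c∷cs⊑c'∷cs'
    cs'⊑cs : ColumnRefines n (k * 4) (label (bands cs')) (label (bands cs))
    cs'⊑cs = stack-refinesʳ (band B') (band B) (bands cs') (bands cs) c'∷cs'⊑c∷cs

  tiling : Vec Choice q → Tiling n
  tiling cs = toTiling (resize 4q+e≡n (stack (bands cs) (rows e)))

  tiling-injective : ∀ cs cs' → SamePartition (tiling cs) (tiling cs') → cs ≡ cs'
  tiling-injective cs cs' same = bands-injective cs cs'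
    (stack-refinesˡ (bands cs) (bands cs') (rows e) (rows e) (samePartition⇒columnRefines 4q+e≡n same))
    (stack-refinesˡ (bands cs') (bands cs) (rows e) (rows e) (samePartition⇒columnRefines 4q+e≡n (⇔-sym ∘₂ same)))

  choices : List (Vec Choice q)
  choices = vectors q (cartesianProduct (vectors u (allFin 19)) (vectors u (allFin 19)))

  tilings : List (Tiling n)
  tilings = map tiling choices

  tilings-distinct : PairwiseDistinct tilings
  tilings-distinct = AllPairs.map⁺ (AllPairs.map (λ cs≢cs' same → cs≢cs' (tiling-injective _ _ same))
    (vectors-unique q (Unique.cartesianProduct⁺ (vectors-unique u (Unique.allFin⁺ 19)) (vectors-unique u (Unique.allFin⁺ 19)))))

  length-tilings : length tilings ≡ 19 ^ ((u + u) * q)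
  length-tilings = begin
    length (map tiling choices)  ≡⟨ length-map tiling choices ⟩
    length choices               ≡⟨ length-vectors q _ ⟩
    length (cartesianProduct (vectors u (allFin 19)) (vectors u (allFin 19))) ^ q
                                 ≡⟨ cong (_^ q) (length-cartesianProductWith _,_ (vectors u (allFin 19)) _) ⟩
    (length (vectors u (allFin 19)) * length (vectors u (allFin 19))) ^ q
                                 ≡⟨ cong (λ l → (l * l) ^ q) (length-vectors u (allFin 19)) ⟩
    (19 ^ u * 19 ^ u) ^ q        ≡⟨ cong (_^ q) (^-distribˡ-+-* 19 u u) ⟨
    (19 ^ (u + u)) ^ q           ≡⟨ ^-*-assoc 19 (u + u) q ⟩
    19 ^ ((u + u) * q)           ∎
    where open ≡-Reasoning

-- Growth

^-distrib-* : ∀ x y k → (x * y) ^ k ≡ x ^ k * y ^ k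
^-distrib-* x y zero    = refl
^-distrib-* x y (suc k) = trans (cong (x * y *_) (^-distrib-* x y k)) (interchange-* x y (x ^ k) (y ^ k))
  where
  interchange-* : ∀ a b c d → a * b * (c * d) ≡ a * c * (b * d)
  interchange-* = solve-∀

^-regroup : ∀ x i j k l → i * j ≡ k * l → (x ^ i) ^ j ≡ (x ^ k) ^ l
^-regroup x i j k l eq = trans (^-*-assoc x i j) (trans (cong (x ^_) eq) (sym (^-*-assoc x k l)))

^-cancelʳ-≤ : ∀ k .{{_ : NonZero k}} {x y} → x ^ k ≤ y ^ k → x ≤ y
^-cancelʳ-≤ k xᵏ≤yᵏ = ≮⇒≥ (λ y<x → <⇒≱ (^-monoˡ-< k y<x) xᵏ≤yᵏ)

-- Bernoulli's (1 + 1/R)^n ≥ 1 + n/R, multiplied by R^(n+1).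
bernoulli : ∀ R n → R ^ n * (R + n) ≤ R * suc R ^ n
bernoulli R zero    = ≤-reflexive (trans (+-identityʳ (R + 0)) (trans (+-identityʳ R) (sym (*-identityʳ R))))
bernoulli R (suc n) = begin
  R * R ^ n * (R + suc n)             ≡⟨ expand R (R ^ n) n ⟩
  R * (R ^ n * (R + n)) + R * R ^ n   ≤⟨ +-mono-≤ (*-monoʳ-≤ R (bernoulli R n)) (*-monoʳ-≤ R Rⁿ≤[1+R]ⁿ) ⟩
  R * (R * suc R ^ n) + R * suc R ^ n ≡⟨ collect R (suc R ^ n) ⟩
  R * (suc R * suc R ^ n)             ∎
  where
  open ≤-Reasoning
  Rⁿ≤[1+R]ⁿ : R ^ n ≤ suc R ^ n
  Rⁿ≤[1+R]ⁿ = ^-monoˡ-≤ n (n≤1+n R)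
  expand : ∀ R X n → R * X * (R + suc n) ≡ R * (X * (R + n)) + R * X
  expand = solve-∀
  collect : ∀ R Y → R * (R * Y) + R * Y ≡ R * (suc R * Y)
  collect = solve-∀

power-step : ∀ R K n .{{_ : NonZero R}} → K * R ≤ n → R ^ n * K ≤ suc R ^ n
power-step R K n KR≤n = *-cancelˡ-≤ R (begin
  R * (R ^ n * K) ≡⟨ rearrange R (R ^ n) K ⟩
  R ^ n * (K * R) ≤⟨ *-monoʳ-≤ (R ^ n) (≤-trans KR≤n (m≤n+m n R)) ⟩
  R ^ n * (R + n) ≤⟨ bernoulli R n ⟩
  R * suc R ^ n   ∎)
  where
  open ≤-Reasoning
  rearrange : ∀ R X K → R * (X * K) ≡ X * (K * R)
  rearrange = solve-∀

power-growth : ∀ R Q c n .{{_ : NonZero R}} → R < Q → Q ^ c * R ≤ n → R ^ (n * n) * Q ^ (c * n) ≤ Q ^ (n * n)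
power-growth R Q c n R<Q QᶜR≤n = begin
  R ^ (n * n) * Q ^ (c * n) ≡⟨ cong₂ _*_ (^-*-assoc R n n) (^-*-assoc Q c n) ⟨
  (R ^ n) ^ n * (Q ^ c) ^ n ≡⟨ ^-distrib-* (R ^ n) (Q ^ c) n ⟨
  (R ^ n * Q ^ c) ^ n       ≤⟨ ^-monoˡ-≤ n (power-step R (Q ^ c) n QᶜR≤n) ⟩
  (suc R ^ n) ^ n           ≤⟨ ^-monoˡ-≤ n (^-monoˡ-≤ n R<Q) ⟩
  (Q ^ n) ^ n               ≡⟨ ^-*-assoc Q n n ⟩
  Q ^ (n * n)               ∎
  where open ≤-Reasoning

3¹⁶<19⁶ : 3 ^ 16 < 19 ^ 6
3¹⁶<19⁶ = from-yes (3 ^ 16 <? 19 ^ 6)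

growth-bound : ∀ a b n E → a ^ 6 ≤ 3 * b ^ 6 → n * n ≤ 16 * E + 13 * n → 19 ^ 78 * 3 ^ 16 ≤ n →
               a ^ (n * n) ≤ 19 ^ E * b ^ (n * n)
growth-bound a b n E a⁶≤3b⁶ n²≤16E+13n n-large = ^-cancelʳ-≤ 96 (begin
  (a ^ (n * n)) ^ 96                             ≡⟨ ^-regroup a (n * n) 96 6 (16 * (n * n)) (regroup (n * n)) ⟩
  (a ^ 6) ^ (16 * (n * n))                       ≤⟨ ^-monoˡ-≤ (16 * (n * n)) a⁶≤3b⁶ ⟩
  (3 * b ^ 6) ^ (16 * (n * n))                   ≡⟨ ^-distrib-* 3 (b ^ 6) (16 * (n * n)) ⟩
  3 ^ (16 * (n * n)) * (b ^ 6) ^ (16 * (n * n))  ≡⟨ cong (_* (b ^ 6) ^ (16 * (n * n))) (^-*-assoc 3 16 (n * n)) ⟨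
  (3 ^ 16) ^ (n * n) * (b ^ 6) ^ (16 * (n * n))  ≤⟨ *-monoˡ-≤ ((b ^ 6) ^ (16 * (n * n))) 3¹⁶ⁿⁿ≤19⁹⁶ᴱ ⟩
  (19 ^ 6) ^ (16 * E) * (b ^ 6) ^ (16 * (n * n)) ≡⟨ cong₂ _*_ (^-regroup 19 6 (16 * E) E 96 (sym (regroup E)))
                                                              (^-regroup b 6 (16 * (n * n)) (n * n) 96 (sym (regroup (n * n)))) ⟩
  (19 ^ E) ^ 96 * (b ^ (n * n)) ^ 96             ≡⟨ ^-distrib-* (19 ^ E) (b ^ (n * n)) 96 ⟨
  (19 ^ E * b ^ (n * n)) ^ 96                    ∎)
  where
  open ≤-Reasoning
  regroup : ∀ x → x * 96 ≡ 6 * (16 * x)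
  regroup = solve-∀
  3¹⁶ⁿⁿ≤19⁹⁶ᴱ : (3 ^ 16) ^ (n * n) ≤ (19 ^ 6) ^ (16 * E)
  3¹⁶ⁿⁿ≤19⁹⁶ᴱ = *-cancelʳ-≤ _ _ ((19 ^ 6) ^ (13 * n)) {{m^n≢0 (19 ^ 6) (13 * n)}} (begin
    (3 ^ 16) ^ (n * n) * (19 ^ 6) ^ (13 * n)  ≤⟨ power-growth (3 ^ 16) (19 ^ 6) 13 n 3¹⁶<19⁶ n-large ⟩
    (19 ^ 6) ^ (n * n)                        ≤⟨ ^-monoʳ-≤ (19 ^ 6) n²≤16E+13n ⟩
    (19 ^ 6) ^ (16 * E + 13 * n)              ≡⟨ ^-distribˡ-+-* (19 ^ 6) (16 * E) (13 * n) ⟩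
    (19 ^ 6) ^ (16 * E) * (19 ^ 6) ^ (13 * n) ∎)

euclid : ∀ n d .{{_ : NonZero d}} → ∃ λ q → ∃ λ r → r < d × q * d + r ≡ n
euclid n d = n / d , n % d , m%n<n n d , trans (+-comm (n / d * d) (n % d)) (sym (m≡m%n+[m/n]*n n d))

square-bound : ∀ n q u → q * 4 ≤ n → n ≤ q * 4 + 3 → u * 8 ≤ n → n ≤ u * 8 + 9 → 27 ≤ n →
               n * n ≤ 16 * ((u + u) * q) + 13 * n
square-bound n q u 4q≤n n≤4q+3 8u≤n n≤8u+9 27≤n = begin
  n * n                                                 ≤⟨ *-mono-≤ n≤4q+3 n≤8u+9 ⟩
  (q * 4 + 3) * (u * 8 + 9)                             ≡⟨ expand q u ⟩
  16 * ((u + u) * q) + (9 * (q * 4) + 3 * (u * 8) + 27) ≤⟨ +-monoʳ-≤ (16 * ((u + u) * q))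
                                                             (+-mono-≤ (+-mono-≤ (*-monoʳ-≤ 9 4q≤n) (*-monoʳ-≤ 3 8u≤n)) 27≤n) ⟩
  16 * ((u + u) * q) + (9 * n + 3 * n + n)              ≡⟨ cong (16 * ((u + u) * q) +_) (collect n) ⟩
  16 * ((u + u) * q) + 13 * n                           ∎
  where
  open ≤-Reasoning
  expand : ∀ q u → (q * 4 + 3) * (u * 8 + 9) ≡ 16 * ((u + u) * q) + (9 * (q * 4) + 3 * (u * 8) + 27)
  expand = solve-∀
  collect : ∀ n → 9 * n + 3 * n + n ≡ 13 * n
  collect = solve-∀

layout : ∀ {n} → 27 ≤ n → Σ (Layout n) λ L → let open Layout L in n * n ≤ 16 * ((u + u) * q) + 13 * n
layout {n} 27≤n with euclid n 4 | euclid n 2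
... | _ , _ , _ , _ | zero , p , p<2 , p≡n =
  ⊥-elim (<⇒≱ (≤-<-trans (≤-reflexive (sym p≡n)) p<2) (≤-trans (s≤s (s≤s z≤n)) 27≤n))
... | q , e , e<4 , 4q+e≡n | suc m' , p , p<2 , 2m+p≡n with euclid m' 4
...   | u , f , f<4 , 4u+f≡m' =
  record { q = q ; e = e ; m = suc m' ; p = p ; u = u ; f = f
         ; 4q+e≡n   = 4q+e≡n
         ; n≡m+p+m  = trans (sym 2m+p≡n) (halves (suc m') p)
         ; p≤1      = s≤s⁻¹ p<2
         ; m≡4u+f+1 = cong suc (sym 4u+f≡m')
         } ,
  square-bound n q u 4q≤n n≤4q+3 8u≤n n≤8u+9 27≤n
  where
  open ≤-Reasoning
  halves : ∀ m p → m * 2 + p ≡ m + (p + m)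
  halves = solve-∀
  4q≤n : q * 4 ≤ n
  4q≤n = subst (q * 4 ≤_) 4q+e≡n (m≤m+n (q * 4) e)
  n≤4q+3 : n ≤ q * 4 + 3
  n≤4q+3 = subst (_≤ q * 4 + 3) 4q+e≡n (+-monoʳ-≤ (q * 4) (s≤s⁻¹ e<4))
  8u≤n : u * 8 ≤ n
  8u≤n = begin
    u * 8          ≡⟨ *-assoc u 4 2 ⟨
    u * 4 * 2      ≤⟨ *-monoˡ-≤ 2 (≤-trans (subst (u * 4 ≤_) 4u+f≡m' (m≤m+n (u * 4) f)) (n≤1+n m')) ⟩
    suc m' * 2     ≤⟨ m≤m+n (suc m' * 2) p ⟩
    suc m' * 2 + p ≡⟨ 2m+p≡n ⟩
    n              ∎
  n≤8u+9 : n ≤ u * 8 + 9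
  n≤8u+9 = begin
    n                       ≡⟨ 2m+p≡n ⟨
    suc m' * 2 + p          ≤⟨ +-mono-≤ (*-monoˡ-≤ 2 (s≤s m'≤4u+3)) (s≤s⁻¹ p<2) ⟩
    suc (u * 4 + 3) * 2 + 1 ≡⟨ simplify u ⟩
    u * 8 + 9               ∎
    where
    m'≤4u+3 : m' ≤ u * 4 + 3
    m'≤4u+3 = subst (_≤ u * 4 + 3) 4u+f≡m' (+-monoʳ-≤ (u * 4) (s≤s⁻¹ f<4))
    simplify : ∀ u → suc (u * 4 + 3) * 2 + 1 ≡ u * 8 + 9
    simplify = solve-∀

theorem2 : ∀ (a b : ℕ) → NonZero b → a ^ 6 < 3 * b ^ 6 →
    ∃ λ (N : ℕ) → ∀ (n : ℕ) → n ≥ N →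
      Σ (List (Tiling n)) λ ts → PairwiseDistinct ts × (a ^ (n * n) ≤ length ts * b ^ (n * n))
theorem2 a b _ a⁶<3b⁶ = 27 + 19 ^ 78 * 3 ^ 16 , λ n n≥N →
  let L , n²≤16E+13n = layout (≤-trans (m≤m+n 27 _) n≥N)
      open Layout L
      open Family L
  in tilings , tilings-distinct ,
     subst (λ t → a ^ (n * n) ≤ t * b ^ (n * n)) (sym length-tilings)
       (growth-bound a b n ((u + u) * q) (<⇒≤ a⁶<3b⁶) n²≤16E+13n (≤-trans (m≤n+m _ 27) n≥N))
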